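{- Let $n\geq 4$ and let $G$ be a graph with $G\to K_n$. Let $V\subset G$ be a set of vertices with $2n\leq |V|\leq 3n-3$, let $V_0\subset V$ be any set with $|V_0|\leq 2n-2$, and let $x,y$ be any vertices in $V\setminus V_0$. Then, in any red/blue colouring of the edges of $G$, there exists a monochromatic copy of $K_{n-1}$ in $G\setminus V_0$, say with vertex set $W$, such that either $W\cap V=\{x\}$, or $W\cap V=\{y\}$, or $x,y\notin W\cap V$.
   Context: All graphs are finite and simple; a graph is identified with its vertex set. $G\to H$ means that every colouring of the edges of $G$ with two colours (red and blue) contains a monochromatic copy of $H$. $K_m$ denotes the complete graph on $m$ vertices. $G\setminus V_0$ is the subgraph of $G$ induced on the vertices not in $V_0$. -}

module Defs where

open import Data.Nat using (ℕ)
open import Data.Bool using (Bool)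
open import Data.Fin using (Fin)
open import Data.Fin.Subset using (Subset; _∈_; _∉_)
open import Data.Product using (Σ; _×_; ∃; ∃-syntax)
open import Data.Empty using (⊥)
open import Relation.Nullary using (¬_)
open import Relation.Binary.PropositionalEquality using (_≡_; _≢_)

record Graph : Set₁ where
  field
    N     : ℕ
    Adj   : Fin N → Fin N → Set
    sym   : ∀ {u v} → Adj u v → Adj v u
    irref : ∀ {u} → ¬ Adj u u
open Graph public

-- Two colours: red = true, blue = false.
Colour : Set
Colour = Bool

-- A red/blue colouring of the edges of G: a colour for each pair,
-- required to be symmetric (only its values on edges matter).
record EdgeColouring (G : Graph) : Set where
  field
    col     : Fin (N G) → Fin (N G) → Colour
    col-sym : ∀ u v → col u v ≡ col v u
open EdgeColouring public

-- f : Fin m → Fin N is a copy of K_m in G, all of whose edges have colour k.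
-- (Injectivity of f follows from irreflexivity of Adj.)
MonoClique : (G : Graph) → EdgeColouring G → Colour → (m : ℕ) → (Fin m → Fin (N G)) → Set
MonoClique G c k m f =
  ∀ i j → i ≢ j → Adj G (f i) (f j) × col c (f i) (f j) ≡ k

Arrows : Graph → ℕ → Set
Arrows G m = (c : EdgeColouring G) → ∃[ k ] ∃[ f ] MonoClique G c k m f

InImage : ∀ {m N} → (Fin m → Fin N) → Fin N → Set
InImage {m} f w = ∃[ i ] f i ≡ w

-- Write n = a + 3 with a ≥ 1 and first let x ≠ y.  Give every vertex
-- one of ten types: V₀ and then the other vertices of V ∖ {x, y} are cut
-- into a block A of at most a vertices, a block B of at most a vertices,
-- four single vertices Z₀ … Z₃ and a rest U of at most a vertices; since
-- ∣ V₀ ∣ ≤ 2a + 4, no vertex of U lies in V₀.  Further x has type X, y has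
-- type Y and the vertices outside V type O.  The table `gadget` forces the
-- colour of the edges between certain types (A is red inside, B blue inside)
-- and keeps the colour of the others.  As G → K_n, the recoloured graph has
-- a monochromatic K_n.  A finite check over all 2 × 2¹⁰ colours and sets of
-- types (`verdict`) shows that such a clique either cannot exist or, after
-- deleting at most one vertex, only uses the types {X, O}, {Y, O} or {U, O}:
-- then none of its edges was recoloured and it is the required K_{n-1}.  When
-- x = y, apply this to x and another vertex of V ∖ V₀, which exists since
-- ∣ V ∣ ≥ 2n.
module Submission where

open import Defs
open import Data.Nat using (ℕ; _≤_; _∸_; _*_; _+_)
open import Data.Fin using (Fin)
open import Data.Fin.Subset using (Subset; _∈_; _∉_; _⊆_; ∣_∣)
open import Data.Product using (Σ; _×_; ∃; ∃-syntax)
open import Data.Sum using (_⊎_)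
open import Relation.Nullary using (¬_)
open import Relation.Binary.PropositionalEquality using (_≡_)

open import Data.Bool using (true; false; not)
open import Data.Bool.Properties using (not-¬) renaming (_≟_ to _≟ᵇ_)
open import Data.Empty using (⊥-elim)
open import Data.Fin using (zero; suc; _≟_; toℕ; fromℕ<; punchIn; _↑ˡ_)
open import Data.Fin.Properties using (all?; any?; injective⇒≤; toℕ-fromℕ<; punchIn-injective; punchInᵢ≢i)
open import Data.Fin.Subset using (_∪_; _─_; _-_; ⁅_⁆; Nonempty; inside; outside) renaming (⊥ to ∅)
open import Data.Fin.Subset.Properties
  using (_∈?_; _⊆?_; ⊆-trans; drop-∷-⊆; drop-there; ∉⊥; ∣⁅x⁆∣≡1; x∈⁅x⁆; x∈⁅y⁆⇒x≡y;
         x∈p∪q⁺; x∈p∪q⁻; x∈p∧x∉q⇒x∈p─q; x∈p∧x≢y⇒x∈p-y)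
open import Data.Maybe using (Maybe; just; nothing; fromMaybe)
open import Data.Maybe.Properties using (≡-dec)
open import Data.Nat using (zero; suc; _<_; z≤n; s≤s)
open import Data.Nat.Properties
  using (≤-trans; <-≤-trans; <-irrefl; <⇒≢; <⇒≱; n<1+n; m<n⇒m<1+n; n≢0⇒n>0; m≤m+n;
         +-suc; +-assoc; +-monoʳ-≤; +-monoʳ-<; +-cancelˡ-≡; +-cancelʳ-≤; +-cancelˡ-<; m+n∸m≡n)
  renaming (suc-injective to ℕ-suc-injective)
open import Data.Nat.Tactic.RingSolver using (solve-∀)
open import Data.Product using (_,_; proj₁; proj₂; ∃₂)
import Data.Product as Σ
open import Data.Sum using (inj₁; inj₂)
import Data.Sum as Sum
open import Data.Vec using (Vec; []; _∷_; lookup; here; there)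
open import Function using (_∘_; id)
open import Relation.Nullary using (Dec; yes; no; ¬?; contradiction)
open import Relation.Nullary.Decidable using (map′; _×-dec_; _⊎-dec_; _→-dec_; from-yes; from-no)
open import Relation.Binary.PropositionalEquality
  using (_≢_; refl; trans; cong; cong₂; subst; subst₂; module ≡-Reasoning) renaming (sym to ≡-sym)

image : ∀ {m n} → (Fin m → Fin n) → Subset n
image {zero}  g = ∅
image {suc m} g = ⁅ g zero ⁆ ∪ image (g ∘ suc)

∈-image : ∀ {m n} (g : Fin m → Fin n) i → g i ∈ image g
∈-image g zero    = x∈p∪q⁺ (inj₁ (x∈⁅x⁆ (g zero)))
∈-image g (suc i) = x∈p∪q⁺ (inj₂ (∈-image (g ∘ suc) i))

image⁻ : ∀ {m n} (g : Fin m → Fin n) {t} → t ∈ image g → ∃ λ i → g i ≡ t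
image⁻ {zero}  g t∈ = ⊥-elim (∉⊥ t∈)
image⁻ {suc m} g t∈ with x∈p∪q⁻ ⁅ g zero ⁆ (image (g ∘ suc)) t∈
... | inj₁ t∈g0 = zero , ≡-sym (x∈⁅y⁆⇒x≡y (g zero) t∈g0)
... | inj₂ t∈gs = Σ.map suc id (image⁻ (g ∘ suc) t∈gs)

image-⊆ : ∀ {m n} (g : Fin m → Fin n) {q} → (∀ i → g i ∈ q) → image g ⊆ q
image-⊆ g g∈q t∈ with image⁻ g t∈
... | i , refl = g∈q i

∈-⁅⁆∪ : ∀ {n} {s t : Fin n} {q} → t ∈ ⁅ s ⁆ ∪ q → t ≡ s ⊎ t ∈ q
∈-⁅⁆∪ {s = s} {q = q} t∈ = Sum.map₁ (x∈⁅y⁆⇒x≡y s) (x∈p∪q⁻ ⁅ s ⁆ q t∈)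

position : ∀ {n} → Subset n → Fin n → ℕ
position (_       ∷ p) zero    = 0
position (inside  ∷ p) (suc v) = suc (position p v)
position (outside ∷ p) (suc v) = position p v

position< : ∀ {n} {p : Subset n} {v} → v ∈ p → position p v < ∣ p ∣
position< here                           = s≤s z≤n
position< {p = inside  ∷ p} (there v∈p) = s≤s (position< v∈p)
position< {p = outside ∷ p} (there v∈p) = position< v∈p

position-injective : ∀ {n} {p : Subset n} {v w} → v ∈ p → w ∈ p → position p v ≡ position p w → v ≡ w
position-injective here here _ = refl
position-injective {p = inside  ∷ p} here (there _) ()
position-injective {p = inside  ∷ p} (there _) here ()
position-injective {p = inside  ∷ p} (there v∈p) (there w∈p) eq = cong suc (position-injective v∈p w∈p (ℕ-suc-injective eq))
position-injective {p = outside ∷ p} (there v∈p) (there w∈p) eq = cong suc (position-injective v∈p w∈p eq)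

∣p─q∣+∣q∣ : ∀ {n} {p q : Subset n} → q ⊆ p → ∣ p ─ q ∣ + ∣ q ∣ ≡ ∣ p ∣
∣p─q∣+∣q∣ {p = []}          {[]}          _   = refl
∣p─q∣+∣q∣ {p = inside  ∷ p} {inside  ∷ q} q⊆p = trans (+-suc _ _) (cong suc (∣p─q∣+∣q∣ (drop-∷-⊆ q⊆p)))
∣p─q∣+∣q∣ {p = inside  ∷ p} {outside ∷ q} q⊆p = cong suc (∣p─q∣+∣q∣ (drop-∷-⊆ q⊆p))
∣p─q∣+∣q∣ {p = outside ∷ p} {outside ∷ q} q⊆p = ∣p─q∣+∣q∣ (drop-∷-⊆ q⊆p)
∣p─q∣+∣q∣ {p = outside ∷ p} {inside  ∷ q} q⊆p = contradiction (q⊆p here) λ ()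

∣p-x∣+1 : ∀ {n} {p : Subset n} {x} → x ∈ p → ∣ p - x ∣ + 1 ≡ ∣ p ∣
∣p-x∣+1 {p = p} {x} x∈p = trans (cong (∣ p - x ∣ +_) (≡-sym (∣⁅x⁆∣≡1 x)))
  (∣p─q∣+∣q∣ λ t∈ → subst (_∈ p) (≡-sym (x∈⁅y⁆⇒x≡y x t∈)) x∈p)

∈-─⁻ : ∀ {n} {p q : Subset n} {t} → t ∈ p ─ q → t ∈ p × t ∉ q
∈-─⁻ {p = inside ∷ p} {outside ∷ q} here = here , λ ()
∈-─⁻ {p = s ∷ p} {inside  ∷ q} (there t∈) = Σ.map there (λ t∉ → t∉ ∘ drop-there) (∈-─⁻ t∈)
∈-─⁻ {p = s ∷ p} {outside ∷ q} (there t∈) = Σ.map there (λ t∉ → t∉ ∘ drop-there) (∈-─⁻ t∈)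

nonempty : ∀ {n} (p : Subset n) → 0 < ∣ p ∣ → Nonempty p
nonempty (inside  ∷ p) _   = zero , here
nonempty (outside ∷ p) 0<p = Σ.map suc there (nonempty p 0<p)

injective-below : ∀ {m b} (h : Fin m → ℕ) (h<b : ∀ i → h i < b) → (∀ i j → h i ≡ h j → i ≡ j) → m ≤ b
injective-below h h<b h-inj = injective⇒≤ {f = λ i → fromℕ< (h<b i)} λ {i} {j} eq →
  h-inj i j (trans (≡-sym (toℕ-fromℕ< (h<b i))) (trans (cong toℕ eq) (toℕ-fromℕ< (h<b j))))

clique-injective : ∀ {G} (c : EdgeColouring G) {k m f} → MonoClique G c k m f → ∀ i j → f i ≡ f j → i ≡ j
clique-injective {G} c {f = f} mono i j fi≡fj with i ≟ j
... | yes i≡j = i≡j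
... | no  i≢j = ⊥-elim (irref G (subst (Adj G (f i)) (≡-sym fi≡fj) (proj₁ (mono i j i≢j))))

delete : ∀ {G} (c : EdgeColouring G) {k m f} → MonoClique G c k (suc m) f → (d : Fin (suc m)) → MonoClique G c k m (f ∘ punchIn d)
delete c mono d i j i≢j = mono (punchIn d i) (punchIn d j) (i≢j ∘ punchIn-injective d i j)

pattern red  = true
pattern blue = false

Ty : Set
Ty = Fin 10

pattern A  = zero
pattern B  = suc A
pattern Z₀ = suc B
pattern Z₁ = suc Z₀
pattern Z₂ = suc Z₁
pattern Z₃ = suc Z₂
pattern X  = suc Z₃
pattern Y  = suc X
pattern U  = suc Y
pattern O  = suc U

-- Entry (s , t) is the colour forced on edges between types s and t, or
-- nothing when such edges keep their colour.  A is a red block, B a blue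
-- block; Z₀ … Z₃ are single vertices; X = {x}, Y = {y}; U are the free
-- vertices of V and O the vertices outside V.
gadget : Vec (Vec (Maybe Colour) 10) 10
gadget =
  --  A   B   Z₀  Z₁  Z₂  Z₃  X   Y   U   O
  (r ∷ r ∷ r ∷ r ∷ r ∷ r ∷ r ∷ r ∷ b ∷ b ∷ []) ∷  -- A
  (r ∷ b ∷ r ∷ b ∷ b ∷ b ∷ r ∷ b ∷ r ∷ r ∷ []) ∷  -- B
  (r ∷ r ∷ o ∷ r ∷ r ∷ b ∷ b ∷ b ∷ r ∷ b ∷ []) ∷  -- Z₀
  (r ∷ b ∷ r ∷ o ∷ b ∷ r ∷ r ∷ b ∷ r ∷ b ∷ []) ∷  -- Z₁
  (r ∷ b ∷ r ∷ b ∷ o ∷ b ∷ b ∷ r ∷ r ∷ r ∷ []) ∷  -- Z₂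
  (r ∷ b ∷ b ∷ r ∷ b ∷ o ∷ b ∷ r ∷ r ∷ r ∷ []) ∷  -- Z₃
  (r ∷ r ∷ b ∷ r ∷ b ∷ b ∷ o ∷ r ∷ b ∷ o ∷ []) ∷  -- X
  (r ∷ b ∷ b ∷ b ∷ r ∷ r ∷ r ∷ o ∷ b ∷ o ∷ []) ∷  -- Y
  (b ∷ r ∷ r ∷ r ∷ r ∷ r ∷ b ∷ b ∷ o ∷ o ∷ []) ∷  -- U
  (b ∷ r ∷ b ∷ b ∷ r ∷ r ∷ o ∷ o ∷ o ∷ o ∷ []) ∷  -- O
  []
  where
  r b o : Maybe Colour
  r = just red
  b = just blue
  o = nothing

forced : Ty → Ty → Maybe Colour
forced s t = lookup (lookup gadget s) t

_≟ᶜ_ : (m m′ : Maybe Colour) → Dec (m ≡ m′)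
_≟ᶜ_ = ≡-dec _≟ᵇ_

forced-sym : ∀ s t → forced s t ≡ forced t s
forced-sym = from-yes (all? λ s → all? λ t → forced s t ≟ᶜ forced t s)

Unique : Subset 10
Unique = ⁅ Z₀ ⁆ ∪ ⁅ Z₁ ⁆ ∪ ⁅ Z₂ ⁆ ∪ ⁅ Z₃ ⁆ ∪ ⁅ X ⁆ ∪ ⁅ Y ⁆

-- A type is rigid for colour k if a k-coloured clique contains at most
-- one vertex of it: the type is unique, or forces the other colour on itself.
Rigid : Colour → Ty → Set
Rigid k t = t ∈ Unique ⊎ forced t t ≡ just (not k)

rigid? : ∀ k t → Dec (Rigid k t)
rigid? k t = (t ∈? Unique) ⊎-dec (forced t t ≟ᶜ just (not k))

-- The three families of types a final clique may use: W meets V only in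
-- {x}, only in {y}, or only in free vertices.
WithX WithY WithoutXY : Subset 10
WithX = ⁅ X ⁆ ∪ ⁅ O ⁆
WithY = ⁅ Y ⁆ ∪ ⁅ O ⁆
WithoutXY = ⁅ U ⁆ ∪ ⁅ O ⁆

Good : Subset 10 → Set
Good P = P ⊆ WithX ⊎ P ⊆ WithY ⊎ P ⊆ WithoutXY

good? : ∀ P → Dec (Good P)
good? P = (P ⊆? WithX) ⊎-dec (P ⊆? WithY) ⊎-dec (P ⊆? WithoutXY)

good-⊆ : ∀ {P Q} → Q ⊆ P → Good P → Good Q
good-⊆ Q⊆P (inj₁ P⊆)        = inj₁ (⊆-trans Q⊆P P⊆)
good-⊆ Q⊆P (inj₂ (inj₁ P⊆)) = inj₂ (inj₁ (⊆-trans Q⊆P P⊆))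
good-⊆ Q⊆P (inj₂ (inj₂ P⊆)) = inj₂ (inj₂ (⊆-trans Q⊆P P⊆))

KeptWithin : Subset 10 → Set
KeptWithin F = ∀ s t → s ∈ F → t ∈ F → forced s t ≡ nothing

kept-within? : ∀ F → Dec (KeptWithin F)
kept-within? F = all? λ s → all? λ t → (s ∈? F) →-dec ((t ∈? F) →-dec (forced s t ≟ᶜ nothing))

good-kept : ∀ {P} → Good P → ∀ {s t} → s ∈ P → t ∈ P → forced s t ≡ nothing
good-kept (inj₁ P⊆)        s∈ t∈ = from-yes (kept-within? WithX) _ _ (P⊆ s∈) (P⊆ t∈)
good-kept (inj₂ (inj₁ P⊆)) s∈ t∈ = from-yes (kept-within? WithY) _ _ (P⊆ s∈) (P⊆ t∈)
good-kept (inj₂ (inj₂ P⊆)) s∈ t∈ = from-yes (kept-within? WithoutXY) _ _ (P⊆ s∈) (P⊆ t∈)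

-- Let P be the set of types met by a monochromatic clique of colour k in the
-- recoloured graph.  The verdict on P is one of: two types of P are forced
-- to the other colour (impossible); P is good; P becomes good after removing
-- a rigid type; or P consists of one type T ≠ O and two rigid types, so that
-- the clique is small.
Clash : Colour → Subset 10 → Set
Clash k P = ∃₂ λ s t → s ∈ P × t ∈ P × s ≢ t × forced s t ≡ just (not k)

DropOne : Colour → Subset 10 → Set
DropOne k P = ∃ λ t → t ∈ P × Rigid k t × Good (P - t)

Crowded : Colour → Subset 10 → Set
Crowded k P = ∃ λ T → T ≢ O × ∃₂ λ r₁ r₂ → Rigid k r₁ × Rigid k r₂ × P ⊆ ⁅ T ⁆ ∪ ⁅ r₁ ⁆ ∪ ⁅ r₂ ⁆

Verdict : Colour → Subset 10 → Set
Verdict k P = Clash k P ⊎ Good P ⊎ DropOne k P ⊎ Crowded k P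

verdict? : ∀ k P → Dec (Verdict k P)
verdict? k P = clash? ⊎-dec good? P ⊎-dec dropOne? ⊎-dec crowded?
  where
  clash? = any? λ s → any? λ t → (s ∈? P) ×-dec (t ∈? P) ×-dec ¬? (s ≟ t) ×-dec (forced s t ≟ᶜ just (not k))
  dropOne? = any? λ t → (t ∈? P) ×-dec rigid? k t ×-dec good? (P - t)
  crowded? = any? λ T → ¬? (T ≟ O) ×-dec any? λ r₁ → any? λ r₂ →
               rigid? k r₁ ×-dec rigid? k r₂ ×-dec (P ⊆? ⁅ T ⁆ ∪ ⁅ r₁ ⁆ ∪ ⁅ r₂ ⁆)

∀-subset? : ∀ {n} {P : Subset n → Set} → (∀ p → Dec (P p)) → Dec (∀ p → P p)
∀-subset? {zero}  P? = map′ (λ h → λ { [] → h }) (λ h → h []) (P? [])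
∀-subset? {suc n} P? =
  map′ (λ { (hᵢ , hₒ) → λ { (inside ∷ p) → hᵢ p ; (outside ∷ p) → hₒ p } })
       (λ h → (λ p → h (inside ∷ p)) , (λ p → h (outside ∷ p)))
       (∀-subset? (λ p → P? (inside ∷ p)) ×-dec ∀-subset? (λ p → P? (outside ∷ p)))

-- The gadget works: every set of types, for either colour, has a verdict.
-- This is a finite check over 2 × 2¹⁰ cases.
verdict : ∀ k P → Verdict k P
verdict red  = from-yes (∀-subset? (verdict? red))
verdict blue = from-yes (∀-subset? (verdict? blue))

recolour : ∀ {G} → (Fin (N G) → Ty) → EdgeColouring G → EdgeColouring G
recolour τ c = record
  { col     = λ u v → fromMaybe (col c u v) (forced (τ u) (τ v))
  ; col-sym = λ u v → cong₂ fromMaybe (col-sym c u v) (forced-sym (τ u) (τ v)) }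

Safe : Subset 10
Safe = ⁅ X ⁆ ∪ ⁅ Y ⁆ ∪ ⁅ U ⁆ ∪ ⁅ O ⁆

good-safe : ∀ {P} → Good P → P ⊆ Safe
good-safe (inj₁ P⊆)        = ⊆-trans P⊆ (from-yes (WithX ⊆? Safe))
good-safe (inj₂ (inj₁ P⊆)) = ⊆-trans P⊆ (from-yes (WithY ⊆? Safe))
good-safe (inj₂ (inj₂ P⊆)) = ⊆-trans P⊆ (from-yes (WithoutXY ⊆? Safe))

-- Vertices other than those of type O carry a rank below a
-- which, together with the type, determines them; unique types have rank 0.
record Typing (a N : ℕ) (V V₀ : Subset N) (x y : Fin N) : Set where
  field
    τ           : Fin N → Ty
    rank        : Fin N → ℕ
    rank<       : ∀ v → τ v ≢ O → rank v < a
    rank-unique : ∀ v → τ v ∈ Unique → rank v ≡ 0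
    determined  : ∀ {v w} → τ v ≡ τ w → τ v ≢ O → rank v ≡ rank w → v ≡ w
    type-x      : τ x ≡ X
    type-y      : τ y ≡ Y
    U-avoids-V₀ : ∀ v → τ v ≡ U → v ∉ V₀
    O-avoids-V  : ∀ v → τ v ≡ O → v ∉ V

  unique-type : ∀ {v w} → τ v ≡ τ w → τ v ∈ Unique → v ≡ w
  unique-type {v} {w} τv≡τw τv∈ = determined τv≡τw τv≢O
    (trans (rank-unique v τv∈) (≡-sym (rank-unique w (subst (_∈ Unique) τv≡τw τv∈))))
    where
    τv≢O : τ v ≢ O
    τv≢O τv≡O = from-no (O ∈? Unique) (subst (_∈ Unique) τv≡O τv∈)

  is-x : ∀ {v} → τ v ≡ X → v ≡ x
  is-x τv≡X = unique-type (trans τv≡X (≡-sym type-x)) (subst (_∈ Unique) (≡-sym τv≡X) (from-yes (X ∈? Unique)))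

  is-y : ∀ {v} → τ v ≡ Y → v ≡ y
  is-y τv≡Y = unique-type (trans τv≡Y (≡-sym type-y)) (subst (_∈ Unique) (≡-sym τv≡Y) (from-yes (Y ∈? Unique)))

  safe-avoids-V₀ : V₀ ⊆ V → x ∉ V₀ → y ∉ V₀ → ∀ v → τ v ∈ Safe → v ∉ V₀
  safe-avoids-V₀ V₀⊆V x∉V₀ y∉V₀ v τv∈ with ∈-⁅⁆∪ τv∈
  ... | inj₁ τv≡X = subst (_∉ V₀) (≡-sym (is-x τv≡X)) x∉V₀
  ... | inj₂ τv∈′ with ∈-⁅⁆∪ τv∈′
  ...   | inj₁ τv≡Y = subst (_∉ V₀) (≡-sym (is-y τv≡Y)) y∉V₀
  ...   | inj₂ τv∈″ with ∈-⁅⁆∪ τv∈″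
  ...     | inj₁ τv≡U = U-avoids-V₀ v τv≡U
  ...     | inj₂ τv∈O = O-avoids-V v (x∈⁅y⁆⇒x≡y O τv∈O) ∘ V₀⊆V

Conclusion : (G : Graph) → EdgeColouring G → (V V₀ : Subset (N G)) → (x y : Fin (N G)) → ℕ → Set
Conclusion G c V V₀ x y m = ∃[ k ] ∃[ f ] (MonoClique G c k m f
  × (∀ i → f i ∉ V₀)
  × ((InImage f x × (∀ i → f i ∈ V → f i ≡ x))
     ⊎ (InImage f y × (∀ i → f i ∈ V → f i ≡ y))
     ⊎ (¬ InImage f x × ¬ InImage f y)))

module Recoloured {a} {G : Graph} {V V₀ : Subset (N G)} {x y : Fin (N G)}
                  (T : Typing a (N G) V V₀ x y) (c : EdgeColouring G) where
  open Typing T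

  c′ : EdgeColouring G
  c′ = recolour τ c

  module _ {k m} {f : Fin m → Fin (N G)} (mono : MonoClique G c′ k m f) where

    forced-is-k : ∀ {i j k′} → i ≢ j → forced (τ (f i)) (τ (f j)) ≡ just k′ → k′ ≡ k
    forced-is-k i≢j forced≡k′ = trans (≡-sym (cong (fromMaybe _) forced≡k′)) (proj₂ (mono _ _ i≢j))

    no-clash : ¬ Clash k (image (τ ∘ f))
    no-clash (s , t , s∈ , t∈ , s≢t , forced≡¬k) with image⁻ (τ ∘ f) s∈ | image⁻ (τ ∘ f) t∈
    ... | i , refl | j , refl = not-¬ refl (≡-sym (forced-is-k (s≢t ∘ cong (τ ∘ f)) forced≡¬k))

    rigid-once : ∀ {i j} → Rigid k (τ (f i)) → τ (f i) ≡ τ (f j) → i ≡ j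
    rigid-once {i} {j} (inj₁ unique) τ≡ = clique-injective c′ mono i j (unique-type τ≡ unique)
    rigid-once {i} {j} (inj₂ self) τ≡ with i ≟ j
    ... | yes i≡j = i≡j
    ... | no  i≢j = ⊥-elim (not-¬ refl (≡-sym (forced-is-k i≢j (trans (cong (forced (τ (f i))) (≡-sym τ≡)) self))))

    -- A crowded clique has at most a + 2 vertices: those of type T are
    -- numbered by their ranks below a, the two rigid types by a and a + 1.
    crowded-bound : Crowded k (image (τ ∘ f)) → m ≤ 2 + a
    crowded-bound (T , T≢O , r₁ , r₂ , rigid₁ , rigid₂ , P⊆) =
      injective-below (λ i → code i (which i)) (λ i → code< i (which i)) (λ i j → code-injective i j (which i) (which j))
      where
      Which : Fin m → Set
      Which i = τ (f i) ≡ T ⊎ τ (f i) ≡ r₁ ⊎ τ (f i) ≡ r₂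

      which : ∀ i → Which i
      which i = Sum.map₂ (Sum.map₂ (x∈⁅y⁆⇒x≡y r₂) ∘ ∈-⁅⁆∪) (∈-⁅⁆∪ (P⊆ (∈-image (τ ∘ f) i)))

      code : ∀ i → Which i → ℕ
      code i (inj₁ _)        = rank (f i)
      code i (inj₂ (inj₁ _)) = a
      code i (inj₂ (inj₂ _)) = suc a

      rank<a : ∀ {i} → τ (f i) ≡ T → rank (f i) < a
      rank<a τ≡T = rank< _ (T≢O ∘ trans (≡-sym τ≡T))

      code< : ∀ i w → code i w < 2 + a
      code< i (inj₁ τ≡T)      = m<n⇒m<1+n (m<n⇒m<1+n (rank<a τ≡T))
      code< i (inj₂ (inj₁ _)) = m<n⇒m<1+n (n<1+n a)
      code< i (inj₂ (inj₂ _)) = n<1+n (suc a)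

      code-injective : ∀ i j wᵢ wⱼ → code i wᵢ ≡ code j wⱼ → i ≡ j
      code-injective i j (inj₁ eᵢ) (inj₁ eⱼ) eq =
        clique-injective c′ mono i j (determined (trans eᵢ (≡-sym eⱼ)) (T≢O ∘ trans (≡-sym eᵢ)) eq)
      code-injective i j (inj₂ (inj₁ eᵢ)) (inj₂ (inj₁ eⱼ)) _ = rigid-once (subst (Rigid k) (≡-sym eᵢ) rigid₁) (trans eᵢ (≡-sym eⱼ))
      code-injective i j (inj₂ (inj₂ eᵢ)) (inj₂ (inj₂ eⱼ)) _ = rigid-once (subst (Rigid k) (≡-sym eᵢ) rigid₂) (trans eᵢ (≡-sym eⱼ))
      code-injective i j (inj₁ eᵢ) (inj₂ (inj₁ _)) eq = ⊥-elim (<⇒≢ (rank<a eᵢ) eq)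
      code-injective i j (inj₁ eᵢ) (inj₂ (inj₂ _)) eq = ⊥-elim (<⇒≢ (m<n⇒m<1+n (rank<a eᵢ)) eq)
      code-injective i j (inj₂ (inj₁ _)) (inj₁ eⱼ) eq = ⊥-elim (<⇒≢ (rank<a eⱼ) (≡-sym eq))
      code-injective i j (inj₂ (inj₂ _)) (inj₁ eⱼ) eq = ⊥-elim (<⇒≢ (m<n⇒m<1+n (rank<a eⱼ)) (≡-sym eq))
      code-injective i j (inj₂ (inj₁ _)) (inj₂ (inj₂ _)) eq = ⊥-elim (<⇒≢ (n<1+n a) eq)
      code-injective i j (inj₂ (inj₂ _)) (inj₂ (inj₁ _)) eq = ⊥-elim (<⇒≢ (n<1+n a) (≡-sym eq))

  shrink : ∀ {k m} {f : Fin (suc m) → Fin (N G)} → MonoClique G c′ k (suc m) f → 2 + a < suc m →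
           ∃ λ g → MonoClique G c′ k m g × Good (image (τ ∘ g))
  shrink {k} {m} {f} mono big with verdict k (image (τ ∘ f))
  ... | inj₁ clash = ⊥-elim (no-clash mono clash)
  ... | inj₂ (inj₁ good) = f ∘ suc , delete c′ mono zero , good-⊆ (image-⊆ (τ ∘ f ∘ suc) (∈-image (τ ∘ f) ∘ suc)) good
  ... | inj₂ (inj₂ (inj₂ crowded)) = ⊥-elim (<⇒≱ big (crowded-bound mono crowded))
  ... | inj₂ (inj₂ (inj₁ (t , t∈ , rigid , good))) with image⁻ (τ ∘ f) t∈
  ...   | d , refl = f ∘ punchIn d , delete c′ mono d , good-⊆ (image-⊆ (τ ∘ f ∘ punchIn d) others) good
    where
    others : ∀ i → τ (f (punchIn d i)) ∈ image (τ ∘ f) - τ (f d)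
    others i = x∈p∧x≢y⇒x∈p-y (∈-image (τ ∘ f) (punchIn d i)) λ τ≡ → punchInᵢ≢i d i (≡-sym (rigid-once mono rigid (≡-sym τ≡)))

  pinned : ∀ {z t v} → τ z ≡ t → t ∈ Unique → τ v ∈ ⁅ t ⁆ ∪ ⁅ O ⁆ → v ∈ V → v ≡ z
  pinned τz≡t t∈ τv∈ v∈V with ∈-⁅⁆∪ τv∈
  ... | inj₁ τv≡t = unique-type (trans τv≡t (≡-sym τz≡t)) (subst (_∈ Unique) (≡-sym τv≡t) t∈)
  ... | inj₂ τv∈O = ⊥-elim (O-avoids-V _ (x∈⁅y⁆⇒x≡y O τv∈O) v∈V)

  absent : ∀ {m} {g : Fin m → Fin (N G)} {z} → τ z ∉ image (τ ∘ g) → ¬ InImage g z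
  absent {g = g} τz∉ (i , refl) = τz∉ (∈-image (τ ∘ g) i)

  conclude : V₀ ⊆ V → x ∉ V₀ → y ∉ V₀ → ∀ {k m} {g : Fin m → Fin (N G)} →
             MonoClique G c′ k m g → Good (image (τ ∘ g)) → Conclusion G c V V₀ x y m
  conclude V₀⊆V x∉V₀ y∉V₀ {k} {m} {g} mono good = k , g , kept , avoids , meets good
    where
    τg∈ : ∀ i → τ (g i) ∈ image (τ ∘ g)
    τg∈ = ∈-image (τ ∘ g)

    kept : MonoClique G c k m g
    kept i j i≢j = proj₁ (mono i j i≢j) ,
      trans (≡-sym (cong (fromMaybe _) (good-kept good (τg∈ i) (τg∈ j)))) (proj₂ (mono i j i≢j))

    avoids : ∀ i → g i ∉ V₀
    avoids i = safe-avoids-V₀ V₀⊆V x∉V₀ y∉V₀ (g i) (good-safe good (τg∈ i))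

    meets : Good (image (τ ∘ g)) →
      (InImage g x × (∀ i → g i ∈ V → g i ≡ x)) ⊎ (InImage g y × (∀ i → g i ∈ V → g i ≡ y))
      ⊎ (¬ InImage g x × ¬ InImage g y)
    meets (inj₁ ⊆X) with any? (λ i → g i ≟ x)
    ... | yes x∈g = inj₁ (x∈g , λ i → pinned type-x (from-yes (X ∈? Unique)) (⊆X (τg∈ i)))
    ... | no  x∉g = inj₂ (inj₂ (x∉g , absent λ τy∈ → from-no (Y ∈? WithX) (subst (_∈ WithX) type-y (⊆X τy∈))))
    meets (inj₂ (inj₁ ⊆Y)) with any? (λ i → g i ≟ y)
    ... | yes y∈g = inj₂ (inj₁ (y∈g , λ i → pinned type-y (from-yes (Y ∈? Unique)) (⊆Y (τg∈ i))))
    ... | no  y∉g = inj₂ (inj₂ (absent (λ τx∈ → from-no (X ∈? WithY) (subst (_∈ WithY) type-x (⊆Y τx∈))) , y∉g))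
    meets (inj₂ (inj₂ ⊆U)) = inj₂ (inj₂
      ( absent (λ τx∈ → from-no (X ∈? WithoutXY) (subst (_∈ WithoutXY) type-x (⊆U τx∈)))
      , absent (λ τy∈ → from-no (Y ∈? WithoutXY) (subst (_∈ WithoutXY) type-y (⊆U τy∈)))))

  reduce : Arrows G (3 + a) → V₀ ⊆ V → x ∉ V₀ → y ∉ V₀ → Conclusion G c V V₀ x y (2 + a)
  reduce arrows V₀⊆V x∉V₀ y∉V₀ with arrows c′
  ... | k , f , mono with shrink mono (n<1+n (2 + a))
  ...   | g , mono′ , good = conclude V₀⊆V x∉V₀ y∉V₀ mono′ good

-- The vertices of V other than x and y are
-- numbered 0, 1, 2, …, those of V₀ first; the numbers are then cut into a
-- block of a numbers (type A), a block of a numbers (type B), four single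
-- numbers (Z₀ … Z₃) and the rest (U).

data Below-or-after (a : ℕ) : ℕ → Set where
  below : ∀ {p} → p < a → Below-or-after a p
  after : ∀ q → Below-or-after a (a + q)

below-or-after : ∀ a p → Below-or-after a p
below-or-after zero    p       = after p
below-or-after (suc a) zero    = below (s≤s z≤n)
below-or-after (suc a) (suc p) with below-or-after a p
... | below p<a = below (s≤s p<a)
... | after q   = after q

data Block (a : ℕ) : ℕ → Set where
  inA : ∀ {r} → r < a → Block a r
  inB : ∀ {r} → r < a → Block a (a + r)
  inZ : (i : Fin 4) → Block a (a + (a + toℕ i))
  inU : ∀ r → Block a (a + (a + (4 + r)))

block-tail : ∀ a s → Block a (a + (a + s))
block-tail a 0 = inZ zero
block-tail a 1 = inZ (suc zero)
block-tail a 2 = inZ (suc (suc zero))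
block-tail a 3 = inZ (suc (suc (suc zero)))
block-tail a (suc (suc (suc (suc r)))) = inU r

block : ∀ a p → Block a p
block a p with below-or-after a p
... | below p<a = inA p<a
... | after q with below-or-after a q
...   | below q<a = inB q<a
...   | after s   = block-tail a s

block-type : ∀ {a p} → Block a p → Ty
block-type (inA _) = A
block-type (inB _) = B
block-type (inZ i) = suc (suc (i ↑ˡ 4))
block-type (inU _) = U

block-rank : ∀ {a p} → Block a p → ℕ
block-rank (inA {r} _) = r
block-rank (inB {r} _) = r
block-rank (inZ _)     = 0
block-rank (inU r)     = r

unblock : ℕ → Ty → ℕ → ℕ
unblock a A  r = r
unblock a B  r = a + r
unblock a Z₀ _ = a + (a + 0)
unblock a Z₁ _ = a + (a + 1)
unblock a Z₂ _ = a + (a + 2)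
unblock a Z₃ _ = a + (a + 3)
unblock a U  r = a + (a + (4 + r))
unblock a _  _ = 0

unblock-block : ∀ {a p} (b : Block a p) → unblock a (block-type b) (block-rank b) ≡ p
unblock-block (inA _)                      = refl
unblock-block (inB _)                      = refl
unblock-block (inZ zero)                   = refl
unblock-block (inZ (suc zero))             = refl
unblock-block (inZ (suc (suc zero)))       = refl
unblock-block (inZ (suc (suc (suc zero)))) = refl
unblock-block (inU _)                      = refl

block-injective : ∀ {a p q} (b : Block a p) (b′ : Block a q) →
                  block-type b ≡ block-type b′ → block-rank b ≡ block-rank b′ → p ≡ q
block-injective {a} b b′ t≡ r≡ =
  trans (≡-sym (unblock-block b)) (trans (cong₂ (unblock a) t≡ r≡) (unblock-block b′))

block-rank< : ∀ {a p} → 1 ≤ a → p < a + (a + (4 + a)) → (b : Block a p) → block-rank b < a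
block-rank< _   _ (inA r<a) = r<a
block-rank< _   _ (inB r<a) = r<a
block-rank< 1≤a _ (inZ _)   = 1≤a
block-rank< {a} _ p< (inU r) = +-cancelˡ-< 4 r a (+-cancelˡ-< a _ _ (+-cancelˡ-< a _ _ p<))

block-unique : ∀ {a p} (b : Block a p) → block-type b ∈ Unique → block-rank b ≡ 0
block-unique (inA _) A∈ = contradiction A∈ (from-no (A ∈? Unique))
block-unique (inB _) B∈ = contradiction B∈ (from-no (B ∈? Unique))
block-unique (inZ _) _  = refl
block-unique (inU _) U∈ = contradiction U∈ (from-no (U ∈? Unique))

Special : Subset 10
Special = ⁅ X ⁆ ∪ ⁅ Y ⁆ ∪ ⁅ O ⁆

block-ordinary : ∀ {a p} (b : Block a p) → block-type b ∉ Special
block-ordinary (inA _)                      = from-no (A ∈? Special)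
block-ordinary (inB _)                      = from-no (B ∈? Special)
block-ordinary (inZ zero)                   = from-no (Z₀ ∈? Special)
block-ordinary (inZ (suc zero))             = from-no (Z₁ ∈? Special)
block-ordinary (inZ (suc (suc zero)))       = from-no (Z₂ ∈? Special)
block-ordinary (inZ (suc (suc (suc zero)))) = from-no (Z₃ ∈? Special)
block-ordinary (inU _)                      = from-no (U ∈? Special)

block-U : ∀ {a p} (b : Block a p) → block-type b ≡ U → a + (a + 4) ≤ p
block-U {a} b t≡U = subst (a + (a + 4) ≤_) (unblock-block b)
  (subst (λ t → a + (a + 4) ≤ unblock a t (block-rank b)) (≡-sym t≡U)
         (+-monoʳ-≤ a (+-monoʳ-≤ a (m≤m+n 4 (block-rank b)))))

module Construction {N} (V V₀ : Subset N) (x y : Fin N) where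

  Rest : Subset N
  Rest = V ─ V₀ - x - y

  number : Fin N → ℕ
  number v with v ∈? V₀
  ... | yes _ = position V₀ v
  ... | no  _ = ∣ V₀ ∣ + position Rest v

  Listed : Fin N → Set
  Listed v = v ∈ V × v ≢ x × v ≢ y

  in-Rest : ∀ {v} → Listed v → v ∉ V₀ → v ∈ Rest
  in-Rest (v∈V , v≢x , v≢y) v∉V₀ = x∈p∧x≢y⇒x∈p-y (x∈p∧x≢y⇒x∈p-y (x∈p∧x∉q⇒x∈p─q v∈V v∉V₀) v≢x) v≢y

  number-V₀ : ∀ {v} → v ∈ V₀ → number v < ∣ V₀ ∣
  number-V₀ {v} v∈V₀ with v ∈? V₀
  ... | yes _    = position< v∈V₀
  ... | no v∉V₀ = contradiction v∈V₀ v∉V₀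

  number< : ∀ {v} → Listed v → number v < ∣ V₀ ∣ + ∣ Rest ∣
  number< {v} listed with v ∈? V₀
  ... | yes v∈V₀ = <-≤-trans (position< v∈V₀) (m≤m+n _ _)
  ... | no  v∉V₀ = +-monoʳ-< ∣ V₀ ∣ (position< (in-Rest listed v∉V₀))

  number-injective : ∀ {v w} → Listed v → Listed w → number v ≡ number w → v ≡ w
  number-injective {v} {w} lv lw eq with v ∈? V₀ | w ∈? V₀
  ... | yes v∈ | yes w∈ = position-injective v∈ w∈ eq
  ... | no  v∉ | no  w∉ = position-injective (in-Rest lv v∉) (in-Rest lw w∉) (+-cancelˡ-≡ ∣ V₀ ∣ _ _ eq)
  ... | yes v∈ | no  _  = contradiction eq (<⇒≢ (<-≤-trans (position< v∈) (m≤m+n _ _)))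
  ... | no  _  | yes w∈ = contradiction (≡-sym eq) (<⇒≢ (<-≤-trans (position< w∈) (m≤m+n _ _)))

  size : V₀ ⊆ V → x ∈ V → x ∉ V₀ → y ∈ V → y ∉ V₀ → x ≢ y → ∣ Rest ∣ + 1 + 1 + ∣ V₀ ∣ ≡ ∣ V ∣
  size V₀⊆V x∈V x∉V₀ y∈V y∉V₀ x≢y = begin
    ∣ Rest ∣ + 1 + 1 + ∣ V₀ ∣ ≡⟨ cong (λ s → s + 1 + ∣ V₀ ∣) (∣p-x∣+1 y∈) ⟩
    ∣ V ─ V₀ - x ∣ + 1 + ∣ V₀ ∣ ≡⟨ cong (_+ ∣ V₀ ∣) (∣p-x∣+1 x∈) ⟩
    ∣ V ─ V₀ ∣ + ∣ V₀ ∣         ≡⟨ ∣p─q∣+∣q∣ V₀⊆V ⟩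
    ∣ V ∣                       ∎
    where
    open ≡-Reasoning
    x∈ : x ∈ V ─ V₀
    x∈ = x∈p∧x∉q⇒x∈p─q x∈V x∉V₀
    y∈ : y ∈ V ─ V₀ - x
    y∈ = x∈p∧x≢y⇒x∈p-y (x∈p∧x∉q⇒x∈p─q y∈V y∉V₀) (x≢y ∘ ≡-sym)

  module _ {a} (1≤a : 1 ≤ a) (V₀⊆V : V₀ ⊆ V) (x∈V : x ∈ V) (x∉V₀ : x ∉ V₀) (y∈V : y ∈ V) (y∉V₀ : y ∉ V₀)
           (x≢y : x ≢ y) (small-V₀ : ∣ V₀ ∣ ≤ a + a + 4) (small-V : ∣ V ∣ ≤ a + a + a + 6) where

    number-bound : ∀ {v} → Listed v → number v < a + (a + (4 + a))
    number-bound listed = <-≤-trans (number< listed) (+-cancelʳ-≤ 2 _ _ (subst₂ _≤_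
      (rearrange ∣ Rest ∣ ∣ V₀ ∣) (three-blocks a)
      (subst (_≤ a + a + a + 6) (≡-sym (size V₀⊆V x∈V x∉V₀ y∈V y∉V₀ x≢y)) small-V)))
      where
      rearrange : ∀ r z → r + 1 + 1 + z ≡ z + r + 2
      rearrange = solve-∀
      three-blocks : ∀ a → a + a + a + 6 ≡ a + (a + (4 + a)) + 2
      three-blocks = solve-∀

    V₀-before-U : ∀ {v} → v ∈ V₀ → block-type (block a (number v)) ≢ U
    V₀-before-U {v} v∈V₀ t≡U = <⇒≱ (<-≤-trans (number-V₀ v∈V₀) (subst (∣ V₀ ∣ ≤_) (+-assoc a a 4) small-V₀))
                                   (block-U (block a (number v)) t≡U)

    data Place (v : Fin N) : Set where
      at-x    : v ≡ x → Place v
      at-y    : v ≢ x → v ≡ y → Place v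
      listed  : Listed v → Place v
      outside : v ≢ x → v ≢ y → v ∉ V → Place v

    place : ∀ v → Place v
    place v with v ≟ x | v ≟ y | v ∈? V
    ... | yes v≡x | _       | _       = at-x v≡x
    ... | no  v≢x | yes v≡y | _       = at-y v≢x v≡y
    ... | no  v≢x | no  v≢y | yes v∈V = listed (v∈V , v≢x , v≢y)
    ... | no  v≢x | no  v≢y | no  v∉V = outside v≢x v≢y v∉V

    place-type : ∀ {v} → Place v → Ty
    place-type     (at-x _)        = X
    place-type     (at-y _ _)      = Y
    place-type {v} (listed _)      = block-type (block a (number v))
    place-type     (outside _ _ _) = O

    place-rank : ∀ {v} → Place v → ℕ
    place-rank {v} (listed _) = block-rank (block a (number v))
    place-rank     _          = 0

    place-rank< : ∀ {v} (p : Place v) → place-type p ≢ O → place-rank p < a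
    place-rank<     (at-x _)        _   = 1≤a
    place-rank<     (at-y _ _)      _   = 1≤a
    place-rank< {v} (listed l)      _   = block-rank< 1≤a (number-bound l) (block a (number v))
    place-rank<     (outside _ _ _) ≢O = contradiction refl ≢O

    place-rank-unique : ∀ {v} (p : Place v) → place-type p ∈ Unique → place-rank p ≡ 0
    place-rank-unique {v} (listed _) = block-unique (block a (number v))
    place-rank-unique (at-x _)        _ = refl
    place-rank-unique (at-y _ _)      _ = refl
    place-rank-unique (outside _ _ _) _ = refl

    ordinary : ∀ {v} (l : Listed v) {t} → t ∈ Special → place-type (listed l) ≢ t
    ordinary {v} _ t∈ t≡ = block-ordinary (block a (number v)) (subst (_∈ Special) (≡-sym t≡) t∈)

    place-determined : ∀ {v w} (p : Place v) (q : Place w) →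
                       place-type p ≡ place-type q → place-type p ≢ O → place-rank p ≡ place-rank q → v ≡ w
    place-determined (outside _ _ _) _ _ ≢O _ = contradiction refl ≢O
    place-determined (at-x v≡x) (at-x w≡x) _ _ _ = trans v≡x (≡-sym w≡x)
    place-determined (at-y _ v≡y) (at-y _ w≡y) _ _ _ = trans v≡y (≡-sym w≡y)
    place-determined (listed lv) (listed lw) t≡ _ r≡ =
      number-injective lv lw (block-injective (block _ _) (block _ _) t≡ r≡)
    place-determined (at-x _)   (at-y _ _)      ()
    place-determined (at-x _)   (outside _ _ _) ()
    place-determined (at-y _ _) (at-x _)        ()
    place-determined (at-y _ _) (outside _ _ _) ()
    place-determined (at-x _)   (listed lw) t≡ _ _ = ⊥-elim (ordinary lw (from-yes (X ∈? Special)) (≡-sym t≡))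
    place-determined (at-y _ _) (listed lw) t≡ _ _ = ⊥-elim (ordinary lw (from-yes (Y ∈? Special)) (≡-sym t≡))
    place-determined (listed lv) (at-x _)        t≡ _ _ = ⊥-elim (ordinary lv (from-yes (X ∈? Special)) t≡)
    place-determined (listed lv) (at-y _ _)      t≡ _ _ = ⊥-elim (ordinary lv (from-yes (Y ∈? Special)) t≡)
    place-determined (listed lv) (outside _ _ _) t≡ _ _ = ⊥-elim (ordinary lv (from-yes (O ∈? Special)) t≡)

    place-type-x : (p : Place x) → place-type p ≡ X
    place-type-x (at-x _)                = refl
    place-type-x (at-y x≢x _)            = contradiction refl x≢x
    place-type-x (listed (_ , x≢x , _))  = contradiction refl x≢x
    place-type-x (outside x≢x _ _)       = contradiction refl x≢x

    place-type-y : (p : Place y) → place-type p ≡ Y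
    place-type-y (at-x y≡x)              = contradiction (≡-sym y≡x) x≢y
    place-type-y (at-y _ _)              = refl
    place-type-y (listed (_ , _ , y≢y))  = contradiction refl y≢y
    place-type-y (outside _ y≢y _)       = contradiction refl y≢y

    place-U-avoids-V₀ : ∀ {v} (p : Place v) → place-type p ≡ U → v ∉ V₀
    place-U-avoids-V₀ (listed _) t≡U v∈V₀ = V₀-before-U v∈V₀ t≡U

    place-O-avoids-V : ∀ {v} (p : Place v) → place-type p ≡ O → v ∉ V
    place-O-avoids-V (listed l)        t≡O = contradiction t≡O (ordinary l (from-yes (O ∈? Special)))
    place-O-avoids-V (outside _ _ v∉V) _   = v∉V

    typing : Typing a N V V₀ x y
    typing = record
      { τ           = λ v → place-type (place v)
      ; rank        = λ v → place-rank (place v)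
      ; rank<       = λ v → place-rank< (place v)
      ; rank-unique = λ v → place-rank-unique (place v)
      ; determined  = λ {v} {w} → place-determined (place v) (place w)
      ; type-x      = place-type-x (place x)
      ; type-y      = place-type-y (place y)
      ; U-avoids-V₀ = λ v → place-U-avoids-V₀ (place v)
      ; O-avoids-V  = λ v → place-O-avoids-V (place v)
      }

distinct : ∀ {a} {G : Graph} → 1 ≤ a → Arrows G (3 + a) → (V V₀ : Subset (N G)) →
           V₀ ⊆ V → ∣ V₀ ∣ ≤ a + a + 4 → ∣ V ∣ ≤ a + a + a + 6 →
           ∀ {x y} → x ≢ y → x ∈ V → x ∉ V₀ → y ∈ V → y ∉ V₀ →
           (c : EdgeColouring G) → Conclusion G c V V₀ x y (2 + a)
distinct 1≤a arrows V V₀ V₀⊆V small-V₀ small-V {x} {y} x≢y x∈V x∉V₀ y∈V y∉V₀ c =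
  Recoloured.reduce (Construction.typing V V₀ x y 1≤a V₀⊆V x∈V x∉V₀ y∈V y∉V₀ x≢y small-V₀ small-V) c
                    arrows V₀⊆V x∉V₀ y∉V₀

another : ∀ {N} (V V₀ : Subset N) (x : Fin N) → V₀ ⊆ V → x ∈ V → x ∉ V₀ → suc ∣ V₀ ∣ < ∣ V ∣ →
          ∃ λ z → z ∈ V × z ∉ V₀ × z ≢ x
another V V₀ x V₀⊆V x∈V x∉V₀ big with nonempty (V ─ V₀ - x) (n≢0⇒n>0 λ empty → <-irrefl (too-small empty) big)
  where
  too-small : ∣ V ─ V₀ - x ∣ ≡ 0 → suc ∣ V₀ ∣ ≡ ∣ V ∣
  too-small empty = trans (cong (λ s → s + 1 + ∣ V₀ ∣) (≡-sym empty))
                          (trans (cong (_+ ∣ V₀ ∣) (∣p-x∣+1 (x∈p∧x∉q⇒x∈p─q x∈V x∉V₀))) (∣p─q∣+∣q∣ V₀⊆V))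
... | z , z∈ with ∈-─⁻ z∈
...   | z∈V─V₀ , z∉⁅x⁆ with ∈-─⁻ z∈V─V₀
...     | z∈V , z∉V₀ = z , z∈V , z∉V₀ , λ z≡x → z∉⁅x⁆ (subst (_∈ ⁅ x ⁆) (≡-sym z≡x) (x∈⁅x⁆ x))

-- For x = y it suffices to treat x and another vertex z: a clique meeting V
-- only in z avoids x.
coincide : ∀ {G} (c : EdgeColouring G) {V V₀ x z m} → x ∈ V → z ≢ x → Conclusion G c V V₀ x z m → Conclusion G c V V₀ x x m
coincide c x∈V z≢x (k , f , mono , avoids , inj₁ only-x) = k , f , mono , avoids , inj₁ only-x
coincide c x∈V z≢x (k , f , mono , avoids , inj₂ (inj₂ (x∉f , _))) = k , f , mono , avoids , inj₂ (inj₂ (x∉f , x∉f))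
coincide c {V = V} x∈V z≢x (k , f , mono , avoids , inj₂ (inj₁ (_ , only-z))) =
  k , f , mono , avoids , inj₂ (inj₂ (x∉f , x∉f))
  where
  x∉f : ¬ InImage f _
  x∉f (i , fi≡x) = z≢x (trans (≡-sym (only-z i (subst (_∈ V) (≡-sym fi≡x) x∈V))) fi≡x)

main : ∀ {a} {G : Graph} → 1 ≤ a → Arrows G (3 + a) → (V V₀ : Subset (N G)) →
       V₀ ⊆ V → ∣ V₀ ∣ ≤ a + a + 4 → ∣ V ∣ ≤ a + a + a + 6 → suc ∣ V₀ ∣ < ∣ V ∣ →
       ∀ x y → x ∈ V → x ∉ V₀ → y ∈ V → y ∉ V₀ → (c : EdgeColouring G) → Conclusion G c V V₀ x y (2 + a)
main 1≤a arrows V V₀ V₀⊆V small-V₀ small-V spare x y x∈V x∉V₀ y∈V y∉V₀ c with x ≟ y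
... | no x≢y = distinct 1≤a arrows V V₀ V₀⊆V small-V₀ small-V x≢y x∈V x∉V₀ y∈V y∉V₀ c
... | yes refl with another V V₀ x V₀⊆V x∈V x∉V₀ spare
...   | z , z∈V , z∉V₀ , z≢x =
  coincide c x∈V z≢x (distinct 1≤a arrows V V₀ V₀⊆V small-V₀ small-V (z≢x ∘ ≡-sym) x∈V x∉V₀ z∈V z∉V₀ c)

twice : ∀ a → 2 * (3 + a) ≡ 2 + (a + a + 4)
twice = solve-∀

thrice : ∀ a → 3 * (3 + a) ≡ 3 + (a + a + a + 6)
thrice = solve-∀

lemma3 : (n : ℕ) → 4 ≤ n → (G : Graph) → Arrows G n →
    (V V₀ : Subset (N G)) → 2 * n ≤ ∣ V ∣ → ∣ V ∣ ≤ 3 * n ∸ 3 →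
    V₀ ⊆ V → ∣ V₀ ∣ ≤ 2 * n ∸ 2 →
    (x y : Fin (N G)) → x ∈ V → x ∉ V₀ → y ∈ V → y ∉ V₀ →
    (c : EdgeColouring G) →
    ∃[ k ] ∃[ f ] (MonoClique G c k (n ∸ 1) f
      × (∀ i → f i ∉ V₀)
      × ((InImage f x × (∀ i → f i ∈ V → f i ≡ x))
         ⊎ (InImage f y × (∀ i → f i ∈ V → f i ≡ y))
         ⊎ (¬ InImage f x × ¬ InImage f y)))
lemma3 (suc (suc (suc a))) (s≤s (s≤s (s≤s 1≤a))) G arrows V V₀ 2n≤∣V∣ ∣V∣≤3n-3 V₀⊆V ∣V₀∣≤2n-2 =
  main 1≤a arrows V V₀ V₀⊆V small-V₀ small-V spare
  where
  small-V₀ : ∣ V₀ ∣ ≤ a + a + 4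
  small-V₀ = subst (∣ V₀ ∣ ≤_) (trans (cong (_∸ 2) (twice a)) (m+n∸m≡n 2 _)) ∣V₀∣≤2n-2
  small-V : ∣ V ∣ ≤ a + a + a + 6
  small-V = subst (∣ V ∣ ≤_) (trans (cong (_∸ 3) (thrice a)) (m+n∸m≡n 3 _)) ∣V∣≤3n-3
  spare : suc ∣ V₀ ∣ < ∣ V ∣
  spare = ≤-trans (s≤s (s≤s small-V₀)) (subst (_≤ ∣ V ∣) (twice a) 2n≤∣V∣)
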